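{- Let $P$, $Q$, $R$ be parts of a system $S$. Then: (1) For every constraint $\phi$ on $P$, $\Diamond^P_R\phi\vdash\Diamond^Q_R\Diamond^P_Q\phi$. (2) For every constraint $\phi$ on $P$, $\Box^Q_R\Box^P_Q\phi\vdash\Box^P_R\phi$.
   Context: A system $S$ is modeled by a set $B_S$ of possible behaviors. A part $P$ of $S$ is a surjective function $|_P\colon B_S\to B_P$; write $s|_P$ for its value. A constraint on $P$ is a predicate $\phi\colon B_P\to\{\mathtt{true},\mathtt{false}\}$, and $\phi\vdash\psi$ means pointwise implication. Allowance: $\Diamond^P_Q\phi(q)=\exists s\in B_S.\,(s|_Q=q)\wedge\phi(s|_P)$, a constraint on $Q$. Ensurance: $\Box^P_Q\phi(q)=\forall s\in B_S.\,(s|_Q=q)\Rightarrow\phi(s|_P)$. -}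

module Defs where

open import Level using (Level; _⊔_; suc)
open import Data.Product using (Σ; ∃; _×_; _,_)
open import Relation.Binary.PropositionalEquality using (_≡_)
open import Relation.Unary using (Pred; _⊆_)
open import Function.Definitions using (Surjective)

record Part {a : Level} (BS : Set a) (b : Level) : Set (a ⊔ suc b) where
  field
    Beh      : Set b
    restrict : BS → Beh
    surj     : Surjective _≡_ _≡_ restrict
open Part public

Constraint : ∀ {a b} {BS : Set a} → Part BS b → (ℓ : Level) → Set (b ⊔ suc ℓ)
Constraint P ℓ = Pred (Beh P) ℓ

_⊢_ : ∀ {b ℓ₁ ℓ₂} {B : Set b} → Pred B ℓ₁ → Pred B ℓ₂ → Set (b ⊔ ℓ₁ ⊔ ℓ₂)
φ ⊢ ψ = φ ⊆ ψ

◇ : ∀ {a b c ℓ} {BS : Set a} (P : Part BS b) (Q : Part BS c) →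
    Pred (Beh P) ℓ → Pred (Beh Q) (a ⊔ c ⊔ ℓ)
◇ {BS = BS} P Q φ q = Σ BS λ s → (restrict Q s ≡ q) × φ (restrict P s)

□ : ∀ {a b c ℓ} {BS : Set a} (P : Part BS b) (Q : Part BS c) →
    Pred (Beh P) ℓ → Pred (Beh Q) (a ⊔ c ⊔ ℓ)
□ {BS = BS} P Q φ q = (s : BS) → restrict Q s ≡ q → φ (restrict P s)

module Submission where

-- Both laws rest on one observation: a behaviour s of the whole system is
-- always a witness for its own restriction to an intermediate part Q.

open import Defs
open import Level using (Level)
open import Data.Product using (_×_; _,_)
open import Relation.Binary.PropositionalEquality using (refl)

module _ {a b c : Level} {BS : Set a} (P : Part BS b) (Q : Part BS c) where

  allowance-self : ∀ {ℓ} (φ : Constraint P ℓ) (s : BS) →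
                   φ (restrict P s) → ◇ P Q φ (restrict Q s)
  allowance-self φ s φs = s , refl , φs

  ensurance-self : ∀ {ℓ} (φ : Constraint P ℓ) (s : BS) →
                   □ P Q φ (restrict Q s) → φ (restrict P s)
  ensurance-self φ s ensured = ensured s refl

module _ {a b c d : Level} {BS : Set a}
         (P : Part BS b) (Q : Part BS c) (R : Part BS d) where

  allowance-compose : ∀ {ℓ} (φ : Constraint P ℓ) →
                      ◇ P R φ ⊢ ◇ Q R (◇ P Q φ)
  allowance-compose φ (s , s|R≡r , φs) = s , s|R≡r , allowance-self P Q φ s φs

  ensurance-compose : ∀ {ℓ} (φ : Constraint P ℓ) →
                      □ Q R (□ P Q φ) ⊢ □ P R φ
  ensurance-compose φ ensured s s|R≡r =
    ensurance-self P Q φ s (ensured s s|R≡r)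

mainTheorem6 : ∀ {a b c d ℓ} {BS : Set a}
    (P : Part BS b) (Q : Part BS c) (R : Part BS d) →
    ((φ : Constraint P ℓ) → ◇ P R φ ⊢ ◇ Q R (◇ P Q φ))
    × ((φ : Constraint P ℓ) → □ Q R (□ P Q φ) ⊢ □ P R φ)
mainTheorem6 P Q R = allowance-compose P Q R , ensurance-compose P Q R
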